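{- Let $n\in\mathbb{N}$ with $n\geq 57$, and let $G=C_n(\{1,4,n-4,n-1\})$. Then $\lambda_{(3,2,1)}(G)=15$ if $n=16k$ for some $k\in\mathbb{N}\cup\{0\}$, and $\lambda_{(3,2,1)}(G)\leq 16$ otherwise.
   Context: For $n\ge 3$ and $S\subseteq\{1,\dots,n-1\}$ closed under $x\mapsto n-x$, the circulant $C_n(S)$ is the graph with vertex set $\{u_1,\dots,u_n\}$ in which $u_iu_j$ is an edge iff $|i-j|\in S$. An $L(3,2,1)$-labeling of a graph $G$ is a function $f:V(G)\to\mathbb{N}\cup\{0\}$ such that $|f(x)-f(y)|>3-\operatorname{dist}_G(x,y)$ for all distinct $x,y\in V(G)$. $\lambda_{(3,2,1)}(G)$ is the minimum, over all $L(3,2,1)$-labelings of $G$, of the difference between the largest and smallest label used. -}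

module Defs where

open import Data.Nat using (ℕ; zero; suc; _+_; _∸_; _≤_; _<_; _⊔_; _⊓_; ∣_-_∣)
open import Data.Fin using (Fin; toℕ)
open import Data.List using (List; _∷_; []; map; foldr)
open import Data.List.Membership.Propositional using (_∈_)

open import Data.List using () renaming (allFin to allFinL)
open import Data.Product using (Σ; _×_)
open import Relation.Nullary using (¬_)
open import Relation.Binary.PropositionalEquality using (_≡_)

-- Vertices of C_n(S): u_1,...,u_n, represented by Fin n (u_{i+1} ↦ i).
-- Adjacency in the circulant C_n(S): |i - j| ∈ S.
CircAdj : (n : ℕ) → List ℕ → Fin n → Fin n → Set
CircAdj n S i j = ∣ toℕ i - toℕ j ∣ ∈ S

S₁₄ : ℕ → List ℕ
S₁₄ n = 1 ∷ 4 ∷ (n ∸ 4) ∷ (n ∸ 1) ∷ []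

data Walk {V : Set} (Adj : V → V → Set) : V → V → ℕ → Set where
  here : ∀ {x} → Walk Adj x x 0
  step : ∀ {x y z k} → Adj x y → Walk Adj y z k → Walk Adj x z (suc k)

IsDist : {V : Set} (Adj : V → V → Set) → V → V → ℕ → Set
IsDist Adj x y d = Walk Adj x y d × (∀ m → m < d → ¬ Walk Adj x y m)

-- L(3,2,1)-labeling: |f x - f y| > 3 - dist(x,y) for distinct x, y,
-- written over ℕ as 3 < dist(x,y) + |f x - f y| (pairs at infinite distance impose nothing).
IsL321 : {V : Set} (Adj : V → V → Set) → (V → ℕ) → Set
IsL321 Adj f = ∀ x y → ¬ (x ≡ y) → ∀ d → IsDist Adj x y d → 3 < d + ∣ f x - f y ∣

maxLabel : (n : ℕ) → (Fin n → ℕ) → ℕ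
maxLabel n f = foldr _⊔_ 0 (map f (allFinL n))

minLabel : (n : ℕ) → (Fin n → ℕ) → ℕ
minLabel n f = foldr _⊓_ (maxLabel n f) (map f (allFinL n))

span : (n : ℕ) → (Fin n → ℕ) → ℕ
span n f = maxLabel n f ∸ minLabel n f

Lambda321≡ : (n : ℕ) → List ℕ → ℕ → Set
Lambda321≡ n S k =
  Σ (Fin n → ℕ) (λ f → IsL321 (CircAdj n S) f × span n f ≡ k)
  × (∀ f → IsL321 (CircAdj n S) f → k ≤ span n f)

Lambda321≤ : (n : ℕ) → List ℕ → ℕ → Set
Lambda321≤ n S k = Σ (Fin n → ℕ) (λ f → IsL321 (CircAdj n S) f × span n f ≤ k)

{-# OPTIONS --safe #-}
module Submission where

-- For n ≥ 25, vertices of C_n(1, 4) at offset s ≤ 12 around the cycle are at distance lineDist s,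
-- the distance from 0 to s in the Cayley graph of (ℤ, {±1, ±4}), and all other pairs are at
-- distance at least 4. So a labelling whose labels at every offset s ≤ 12 differ by at least
-- 4 ∸ lineDist s is an L(3,2,1)-labelling, and every L(3,2,1)-labelling has these gaps on any
-- 22 consecutive vertices.
-- Upper bounds: the pattern 5i mod 17 with the label 16 removed has these gaps with period 16 and
-- labels 0..15; for other n, a word chosen by n mod 16 followed by copies of the pattern, or for
-- seven small n an explicit cyclic word, has them with labels 0..16.
-- Lower bound: an exhaustive search shows that no 22 consecutive vertices carry these gaps with
-- only 15 labels.

open import Defs
open import Data.Bool using (Bool; true; false; _∧_; _∨_; T; if_then_else_)
open import Data.Bool.Properties using (T-∧; T-∨)
open import Data.Empty using (⊥; ⊥-elim)
open import Data.Fin using (Fin; toℕ; fromℕ<)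
open import Data.Fin.Properties using (toℕ<n; toℕ-injective; toℕ-fromℕ<)
open import Data.List using (List; []; _∷_; length; map; upTo; applyUpTo; applyDownFrom; allFin; cartesianProductWith)
open import Data.List.Properties using (foldr-preservesᵇ; foldr-preservesᵒ)
open import Data.List.Membership.Propositional using (_∈_)
open import Data.List.Membership.Propositional.Properties using (∈-upTo⁺; ∈-applyUpTo⁺; ∈-allFin; ∈-map⁺)
open import Data.List.Relation.Unary.All as All using (All)
import Data.List.Relation.Unary.All.Properties as Allₚ
open import Data.List.Relation.Unary.Any as Any using (Any; here; there)
open import Data.List.Relation.Unary.Any.Properties using (cartesianProductWith⁺; ++⁺ˡ)
open import Data.Nat using (ℕ; zero; suc; _+_; _*_; _∸_; _≤_; _<_; z≤n; s≤s; ∣_-_∣; _%_; _/_; _≤ᵇ_; _<ᵇ_; NonZero; >-nonZero)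
open import Data.Nat.DivMod using (m≡m%n+[m/n]*n; m<n⇒m%n≡m; m%n<n; m%n%n≡m%n; [m+n]%n≡m%n; [m+kn]%n≡m%n; %-distribˡ-+; m∣n⇒o%n%m≡o%m; /-monoˡ-≤; m/n≡1+[m∸n]/n)
open import Data.Nat.Divisibility using (_∣_; divides; 0∣⇒≡0; ∣-reflexive)
open import Data.Nat.Properties
open import Data.Nat.Solver using (module +-*-Solver)
open import Data.List.Membership.DecPropositional _≟_ using (_∈?_)
open import Data.Product using (Σ; ∃; _×_; _,_; proj₁; proj₂; uncurry)
open import Data.Sum as Sum using (_⊎_; inj₁; inj₂; [_,_]′)
open import Data.Unit using (tt)
open import Function using (_∘_)
open import Function.Bundles using (Equivalence)
open import Relation.Nullary using (Dec; yes; no; does; ¬_)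
open import Relation.Nullary.Decidable using (True; toWitness; dec-true; dec-false; _×-dec_; _→-dec_)
open import Relation.Binary.PropositionalEquality

open +-*-Solver using (solve; _:=_; _:+_; _:*_; con)

module _ {n} (f : Fin n → ℕ) where

  maxLabel-lub : ∀ {B} → (∀ x → f x ≤ B) → maxLabel n f ≤ B
  maxLabel-lub {B} f≤B = foldr-preservesᵇ {P = _≤ B} ⊔-lub z≤n (Allₚ.map⁺ (All.universal f≤B (allFin n)))

  ≤maxLabel : ∀ x → f x ≤ maxLabel n f
  ≤maxLabel x = foldr-preservesᵒ {P = f x ≤_} (λ a b → [ m≤n⇒m≤n⊔o b , m≤n⇒m≤o⊔n a ]′)
    0 (map f (allFin n)) (inj₂ (Any.map ≤-reflexive (∈-map⁺ f (∈-allFin x))))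

  minLabel≤ : ∀ x → minLabel n f ≤ f x
  minLabel≤ x = foldr-preservesᵒ {P = _≤ f x} (λ a b → [ m≤n⇒m⊓o≤n b , m≤n⇒o⊓m≤n a ]′)
    (maxLabel n f) (map f (allFin n)) (inj₂ (Any.map (≤-reflexive ∘ sym) (∈-map⁺ f (∈-allFin x))))

  span≤ : ∀ {B} → (∀ x → f x ≤ B) → span n f ≤ B
  span≤ f≤B = ≤-trans (m∸n≤m (maxLabel n f) (minLabel n f)) (maxLabel-lub f≤B)

  span≡ : ∀ {B} x₀ x₁ → (∀ x → f x ≤ B) → f x₀ ≡ 0 → f x₁ ≡ B → span n f ≡ B
  span≡ {B} x₀ x₁ f≤B fx₀≡0 fx₁≡B = cong₂ _∸_ max≡B min≡0
    where
    max≡B : maxLabel n f ≡ B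
    max≡B = ≤-antisym (maxLabel-lub f≤B) (subst (_≤ maxLabel n f) fx₁≡B (≤maxLabel x₁))
    min≡0 : minLabel n f ≡ 0
    min≡0 = n≤0⇒n≡0 (subst (minLabel n f ≤_) fx₀≡0 (minLabel≤ x₀))

-- Distances in C_n(1, 4)

Offset : ℕ → ℕ → ℕ → ℕ → Set
Offset n a b d = b ≡ a + d ⊎ b + n ≡ a + d

-- Distance from 0 to s in the Cayley graph of ℤ with generators ±1 and ±4, truncated at 4.
lineDist : ℕ → ℕ
lineDist 0 = 0
lineDist 1 = 1
lineDist 2 = 2
lineDist 3 = 2
lineDist 4 = 1
lineDist 5 = 2
lineDist 6 = 3
lineDist 7 = 3
lineDist 8 = 2
lineDist 9 = 3
lineDist 12 = 3
lineDist _ = 4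

minGap : ℕ → ℕ
minGap s = 4 ∸ lineDist s

-- b ≡ a + p − m (mod n), written without subtraction: u and v count turns around the cycle.
record Displacement (n a b p m : ℕ) : Set where
  constructor displacement
  field
    u v : ℕ
    equation : b + m + u * n ≡ a + p + v * n

Displacement-trans : ∀ {n a b c p m p′ m′} → Displacement n a b p m → Displacement n b c p′ m′ →
                     Displacement n a c (p + p′) (m + m′)
Displacement-trans {n} {a} {b} {c} {p} {m} {p′} {m′} (displacement u v ab) (displacement u′ v′ bc) =
  displacement (u + u′) (v + v′) (+-cancelˡ-≡ b _ _ (begin
    b + (c + (m + m′) + (u + u′) * n)  ≡⟨ solve 8 (λ b c m m′ u u′ n _ →
                                             b :+ (c :+ (m :+ m′) :+ (u :+ u′) :* n)
                                          := (c :+ m′ :+ u′ :* n) :+ (b :+ m :+ u :* n))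
                                          refl b c m m′ u u′ n 0 ⟩
    (c + m′ + u′ * n) + (b + m + u * n) ≡⟨ cong₂ _+_ bc ab ⟩
    (b + p′ + v′ * n) + (a + p + v * n) ≡⟨ solve 8 (λ b a p p′ v v′ n _ →
                                             (b :+ p′ :+ v′ :* n) :+ (a :+ p :+ v :* n)
                                          := b :+ (a :+ (p :+ p′) :+ (v :+ v′) :* n))
                                          refl b a p p′ v v′ n 0 ⟩
    b + (a + (p + p′) + (v + v′) * n)  ∎))
  where open ≡-Reasoning

∣-∣⇒Displacement : ∀ {n a b c} → ∣ a - b ∣ ≡ c → Displacement n a b c 0 ⊎ Displacement n a b 0 c
∣-∣⇒Displacement {n} {a} {b} {c} refl with ≤-total a b
... | inj₁ a≤b = inj₁ (displacement 0 0 (cong (_+ 0) (begin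
  b + 0               ≡⟨ +-identityʳ b ⟩
  b                   ≡⟨ m+[n∸m]≡n a≤b ⟨
  a + (b ∸ a)         ≡⟨ cong (a +_) (m≤n⇒∣m-n∣≡n∸m a≤b) ⟨
  a + ∣ a - b ∣       ∎)))
  where open ≡-Reasoning
... | inj₂ b≤a = inj₂ (displacement 0 0 (cong (_+ 0) (begin
  b + ∣ a - b ∣       ≡⟨ cong (b +_) (m≤n⇒∣n-m∣≡n∸m b≤a) ⟩
  b + (a ∸ b)         ≡⟨ m+[n∸m]≡n b≤a ⟩
  a                   ≡⟨ +-identityʳ a ⟨
  a + 0               ∎)))
  where open ≡-Reasoning

Displacement-sym : ∀ {n a b p m} → Displacement n a b p m → Displacement n b a m p
Displacement-sym (displacement u v eq) = displacement v u (sym eq)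

Displacement-complementˡ : ∀ {n a b g} → g ≤ n → Displacement n a b (n ∸ g) 0 → Displacement n a b 0 g
Displacement-complementˡ {n} {a} {b} {g} g≤n (displacement u v eq) = displacement u (suc v) (begin
  b + g + u * n          ≡⟨ solve 4 (λ b g u n → b :+ g :+ u :* n := b :+ con 0 :+ u :* n :+ g) refl b g u n ⟩
  b + 0 + u * n + g      ≡⟨ cong (_+ g) eq ⟩
  a + (n ∸ g) + v * n + g ≡⟨ solve 5 (λ a d v n g → a :+ d :+ v :* n :+ g := a :+ con 0 :+ (v :* n :+ (d :+ g)))
                                    refl a (n ∸ g) v n g ⟩
  a + 0 + (v * n + (n ∸ g + g)) ≡⟨ cong (λ x → a + 0 + (v * n + x)) (m∸n+n≡m g≤n) ⟩
  a + 0 + (v * n + n)    ≡⟨ cong (a + 0 +_) (+-comm (v * n) n) ⟩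
  a + 0 + suc v * n      ∎)
  where open ≡-Reasoning

Displacement-complementʳ : ∀ {n a b g} → g ≤ n → Displacement n a b 0 (n ∸ g) → Displacement n a b g 0
Displacement-complementʳ g≤n = Displacement-sym ∘ Displacement-complementˡ g≤n ∘ Displacement-sym

generators : List (ℕ × ℕ)
generators = (1 , 0) ∷ (0 , 1) ∷ (4 , 0) ∷ (0 , 4) ∷ []

adjacent⇒generator : ∀ {n} a b → 4 ≤ n → ∣ a - b ∣ ∈ S₁₄ n → Any (uncurry (Displacement n a b)) generators
adjacent⇒generator a b _ (here e) = [ here , (λ d → there (here d)) ]′ (∣-∣⇒Displacement {a = a} {b} e)
adjacent⇒generator a b _ (there (here e)) =
  [ (λ d → there (there (here d))) , (λ d → there (there (there (here d)))) ]′ (∣-∣⇒Displacement {a = a} {b} e)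
adjacent⇒generator a b 4≤n (there (there (here e))) =
  [ (λ d → there (there (there (here (Displacement-complementˡ 4≤n d)))))
  , (λ d → there (there (here (Displacement-complementʳ 4≤n d)))) ]′ (∣-∣⇒Displacement {a = a} {b} e)
adjacent⇒generator a b 4≤n (there (there (there (here e)))) =
  [ (λ d → there (here (Displacement-complementˡ 1≤n d)))
  , (λ d → here (Displacement-complementʳ 1≤n d)) ]′ (∣-∣⇒Displacement {a = a} {b} e)
  where 1≤n = ≤-trans (s≤s z≤n) 4≤n

_⊕_ : ℕ × ℕ → ℕ × ℕ → ℕ × ℕ
(p , m) ⊕ (p′ , m′) = p + p′ , m + m′

displacements : ℕ → List (ℕ × ℕ)
displacements zero    = (0 , 0) ∷ []
displacements (suc k) = cartesianProductWith _⊕_ generators (displacements k)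

walk⇒Displacement : ∀ {n} {x y : Fin n} {k} → 4 ≤ n → Walk (CircAdj n (S₁₄ n)) x y k →
                    Any (uncurry (Displacement n (toℕ x) (toℕ y))) (displacements k)
walk⇒Displacement _ here = here (displacement 0 0 refl)
walk⇒Displacement {x = x} {z} 4≤n (step {y = y} xy yz) =
  cartesianProductWith⁺ _⊕_ (Displacement-trans {a = toℕ x} {toℕ y} {toℕ z})
    (adjacent⇒generator (toℕ x) (toℕ y) 4≤n xy) (walk⇒Displacement 4≤n yz)

congruence⇒Offset : ∀ {n a b d} → a < n → b < n → d < n → ∀ u v → b + u * n ≡ a + d + v * n → Offset n a b d
congruence⇒Offset {n} {a} {b} {d} a<n b<n d<n (suc u) (suc v) eq =
  congruence⇒Offset a<n b<n d<n u v (+-cancelˡ-≡ n _ _ (begin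
    n + (b + u * n)     ≡⟨ +-assoc-comm n b (u * n) ⟩
    b + suc u * n       ≡⟨ eq ⟩
    a + d + suc v * n   ≡⟨ +-assoc-comm n (a + d) (v * n) ⟨
    n + (a + d + v * n) ∎))
  where
  open ≡-Reasoning
  +-assoc-comm : ∀ n x y → n + (x + y) ≡ x + (n + y)
  +-assoc-comm n x y = solve 3 (λ n x y → n :+ (x :+ y) := x :+ (n :+ y)) refl n x y
congruence⇒Offset {n} {a} {b} {d} _ _ _ 0 0 eq = inj₁ (begin
  b                   ≡⟨ +-identityʳ b ⟨
  b + 0               ≡⟨ eq ⟩
  a + d + 0           ≡⟨ +-identityʳ _ ⟩
  a + d               ∎)
  where open ≡-Reasoning
congruence⇒Offset {n} {a} {b} {d} _ _ _ 1 0 eq = inj₂ (begin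
  b + n               ≡⟨ cong (b +_) (+-identityʳ n) ⟨
  b + 1 * n           ≡⟨ eq ⟩
  a + d + 0           ≡⟨ +-identityʳ _ ⟩
  a + d               ∎)
  where open ≡-Reasoning
congruence⇒Offset {n} {a} {b} {d} _ b<n _ 0 (suc v) eq = ⊥-elim (<⇒≱ b<n (begin
  n                   ≤⟨ m≤m+n n (v * n) ⟩
  suc v * n           ≤⟨ m≤n+m _ (a + d) ⟩
  a + d + suc v * n   ≡⟨ eq ⟨
  b + 0               ≡⟨ +-identityʳ b ⟩
  b                   ∎))
  where open ≤-Reasoning
congruence⇒Offset {n} {a} {b} {d} a<n _ d<n (suc (suc u)) 0 eq = ⊥-elim (<⇒≱ (+-mono-< a<n d<n) (begin
  n + n               ≤⟨ +-monoʳ-≤ n (m≤m+n n (u * n)) ⟩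
  suc (suc u) * n     ≤⟨ m≤n+m _ b ⟩
  b + suc (suc u) * n ≡⟨ eq ⟩
  a + d + 0           ≡⟨ +-identityʳ _ ⟩
  a + d               ∎))
  where open ≤-Reasoning

Displacement⇒Offset : ∀ {n a b p m} → a < n → b < n → p < n → m < n → Displacement n a b p m →
                      Offset n a b ∣ p - m ∣ ⊎ Offset n b a ∣ p - m ∣
Displacement⇒Offset {n} {a} {b} {p} {m} a<n b<n p<n m<n (displacement u v eq) with ≤-total m p
... | inj₁ m≤p = inj₁ (subst (Offset n a b) (sym (m≤n⇒∣n-m∣≡n∸m m≤p))
  (congruence⇒Offset a<n b<n (≤-<-trans (m∸n≤m p m) p<n) u v (+-cancelˡ-≡ m _ _ (begin
  m + (b + u * n)     ≡⟨ solve 4 (λ m b u n → m :+ (b :+ u :* n) := b :+ m :+ u :* n) refl m b u n ⟩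
  b + m + u * n       ≡⟨ eq ⟩
  a + p + v * n       ≡⟨ cong (λ x → a + x + v * n) (m+[n∸m]≡n m≤p) ⟨
  a + (m + d) + v * n ≡⟨ solve 5 (λ m a d v n → a :+ (m :+ d) :+ v :* n := m :+ (a :+ d :+ v :* n))
                                refl m a d v n ⟩
  m + (a + d + v * n) ∎))))
  where
  open ≡-Reasoning
  d = p ∸ m
... | inj₂ p≤m = inj₂ (subst (Offset n b a) (sym (m≤n⇒∣m-n∣≡n∸m p≤m))
  (congruence⇒Offset b<n a<n (≤-<-trans (m∸n≤m m p) m<n) v u (+-cancelˡ-≡ p _ _ (begin
  p + (a + v * n)     ≡⟨ solve 4 (λ p a v n → p :+ (a :+ v :* n) := a :+ p :+ v :* n) refl p a v n ⟩
  a + p + v * n       ≡⟨ eq ⟨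
  b + m + u * n       ≡⟨ cong (λ x → b + x + u * n) (m+[n∸m]≡n p≤m) ⟨
  b + (p + d) + u * n ≡⟨ solve 5 (λ p b d u n → b :+ (p :+ d) :+ u :* n := p :+ (b :+ d :+ u :* n))
                                refl p b d u n ⟩
  p + (b + d + u * n) ∎))))
  where
  open ≡-Reasoning
  d = m ∸ p

ShortDisplacement : ℕ → ℕ × ℕ → Set
ShortDisplacement k (p , m) = p ≤ 12 × m ≤ 12 × ∣ p - m ∣ ≤ 12 × lineDist ∣ p - m ∣ ≤ k

shortDisplacement? : ∀ k pm → Dec (ShortDisplacement k pm)
shortDisplacement? k (p , m) = p ≤? 12 ×-dec m ≤? 12 ×-dec ∣ p - m ∣ ≤? 12 ×-dec lineDist ∣ p - m ∣ ≤? k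

displacements-short : ∀ k → k ≤ 3 → All (ShortDisplacement k) (displacements k)
displacements-short k k≤3 = All.lookup allShort (∈-upTo⁺ (s≤s k≤3))
  where
  allShort : All (λ k → All (ShortDisplacement k) (displacements k)) (upTo 4)
  allShort = toWitness {a? = All.all? (λ k → All.all? (shortDisplacement? k) (displacements k)) (upTo 4)} tt

shortWalk⇒Offset : ∀ {n} {x y : Fin n} {k} → 13 ≤ n → k ≤ 3 → Walk (CircAdj n (S₁₄ n)) x y k →
                   ∃ λ d → d ≤ 12 × lineDist d ≤ k × (Offset n (toℕ x) (toℕ y) d ⊎ Offset n (toℕ y) (toℕ x) d)
shortWalk⇒Offset {n} {x} {y} {k} 13≤n k≤3 w =
  All.lookupWith short⇒Offset (displacements-short k k≤3) (walk⇒Displacement (≤-trans 4≤13 13≤n) w)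
  where
  4≤13 : 4 ≤ 13
  4≤13 = toWitness {a? = 4 ≤? 13} tt
  <n : ∀ {p} → p ≤ 12 → p < n
  <n p≤12 = ≤-trans (s≤s p≤12) 13≤n
  short⇒Offset : ∀ {pm} → ShortDisplacement k pm → uncurry (Displacement n (toℕ x) (toℕ y)) pm →
                 ∃ λ d → d ≤ 12 × lineDist d ≤ k × (Offset n (toℕ x) (toℕ y) d ⊎ Offset n (toℕ y) (toℕ x) d)
  short⇒Offset {p , m} (p≤12 , m≤12 , d≤12 , short) disp =
    ∣ p - m ∣ , d≤12 , short , Displacement⇒Offset (toℕ<n x) (toℕ<n y) (<n p≤12) (<n m≤12) disp

RespectsGaps : ℕ → (ℕ → ℕ) → Set
RespectsGaps n W = ∀ {a b s} → 1 ≤ s → s ≤ 12 → a < n → b < n → Offset n a b s → minGap s ≤ ∣ W a - W b ∣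

Offset-zero : ∀ {n a b} → a < n → Offset n a b 0 → b ≡ a
Offset-zero {a = a} _   (inj₁ b≡a+0)   = trans b≡a+0 (+-identityʳ a)
Offset-zero {n} {a} {b} a<n (inj₂ b+n≡a+0) =
  ⊥-elim (<⇒≱ a<n (≤-trans (m≤n+m n b) (≤-reflexive (trans b+n≡a+0 (+-identityʳ a)))))

minGap-separates : ∀ {s d δ} → lineDist s ≤ d → minGap s ≤ δ → 3 < d + δ
minGap-separates {s} s≤d gap≤δ = ≤-trans (m≤n+m∸n 4 (lineDist s)) (+-mono-≤ s≤d gap≤δ)

respectsGaps⇒IsL321 : ∀ {n} W → 13 ≤ n → RespectsGaps n W → IsL321 (CircAdj n (S₁₄ n)) (W ∘ toℕ)
respectsGaps⇒IsL321 {n} W 13≤n gaps x y x≢y d (walk , _) with d ≤? 3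
... | no d≰3 = ≤-trans (≰⇒> d≰3) (m≤m+n d _)
... | yes d≤3 with shortWalk⇒Offset 13≤n d≤3 walk
... | zero , _ , _ , inj₁ xy = ⊥-elim (x≢y (toℕ-injective (sym (Offset-zero (toℕ<n x) xy))))
... | zero , _ , _ , inj₂ yx = ⊥-elim (x≢y (toℕ-injective (Offset-zero (toℕ<n y) yx)))
... | suc s , s≤12 , s≤d , inj₁ xy =
  minGap-separates s≤d (gaps (s≤s z≤n) s≤12 (toℕ<n x) (toℕ<n y) xy)
... | suc s , s≤12 , s≤d , inj₂ yx =
  minGap-separates s≤d (subst (minGap (suc s) ≤_) (∣-∣-comm (W (toℕ y)) _)
                                (gaps (s≤s z≤n) s≤12 (toℕ<n y) (toℕ<n x) yx))

-- Labellings by cyclic and prefixed words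

infixl 9 _!_

-- Out-of-range lookups return 0.
_!_ : List ℕ → ℕ → ℕ
[]       ! _     = 0
(x ∷ _)  ! zero  = x
(_ ∷ xs) ! suc i = xs ! i

offsets : List ℕ
offsets = applyUpTo suc 12

∈-offsets : ∀ {s} → 1 ≤ s → s ≤ 12 → s ∈ offsets
∈-offsets {suc s} _ s<12 = ∈-applyUpTo⁺ suc s<12

periodic : List ℕ → ℕ → ℕ
periodic []           _ = 0
periodic C@(_ ∷ _) i = C ! (i % length C)

!-≤ : ∀ {B} {C} → All (_≤ B) C → ∀ i → C ! i ≤ B
!-≤ All.[]         _       = z≤n
!-≤ (x≤B All.∷ _)  zero    = x≤B
!-≤ (_ All.∷ C≤B)  (suc i) = !-≤ C≤B i

periodic-≤ : ∀ {B} {C} → All (_≤ B) C → ∀ i → periodic C i ≤ B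
periodic-≤ {C = []}    _   _ = z≤n
periodic-≤ {C = C@(_ ∷ _)} C≤B i = !-≤ C≤B (i % length C)

HasGap : (ℕ → ℕ) → ℕ → ℕ → Set
HasGap W a s = minGap s ≤ ∣ W a - W (a + s) ∣

hasGap? : ∀ W a s → Dec (HasGap W a s)
hasGap? W a s = minGap s ≤? ∣ W a - W (a + s) ∣

ValidCycle : List ℕ → Set
ValidCycle C = All (λ c → All (HasGap (periodic C) c) offsets) (upTo (length C))

validCycle? : ∀ C → Dec (ValidCycle C)
validCycle? C = All.all? (λ c → All.all? (hasGap? (periodic C) c) offsets) (upTo (length C))

periodic-% : ∀ C .{{_ : NonZero (length C)}} i → periodic C (i % length C) ≡ periodic C i
periodic-% C@(_ ∷ _) i = cong (C !_) (m%n%n≡m%n i (length C))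

periodic-+* : ∀ C i k → periodic C (i + k * length C) ≡ periodic C i
periodic-+* []        _ _ = refl
periodic-+* C@(_ ∷ _) i k = cong (C !_) ([m+kn]%n≡m%n i k (length C))

periodic-+ : ∀ C .{{_ : NonZero (length C)}} i s → periodic C (i % length C + s) ≡ periodic C (i + s)
periodic-+ C@(_ ∷ _) i s = cong (C !_) (begin
  (i % N + s) % N     ≡⟨ %-distribˡ-+ (i % N) s N ⟩
  (i % N % N + s % N) % N ≡⟨ cong (λ x → (x + s % N) % N) (m%n%n≡m%n i N) ⟩
  (i % N + s % N) % N ≡⟨ %-distribˡ-+ i s N ⟨
  (i + s) % N         ∎)
  where
  open ≡-Reasoning
  N = length C

ValidCycle⇒HasGap : ∀ C → ValidCycle C → 0 < length C → ∀ c {s} → 1 ≤ s → s ≤ 12 → HasGap (periodic C) c s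
ValidCycle⇒HasGap C@(_ ∷ _) valid _ c {s} 1≤s s≤12 =
  subst₂ (λ x y → minGap s ≤ ∣ x - y ∣) (periodic-% C c) (periodic-+ C c s)
    (All.lookup (All.lookup valid (∈-upTo⁺ (m%n<n c (length C)))) (∈-offsets 1≤s s≤12))

Offset⇒% : ∀ {n a b s} .{{_ : NonZero n}} → b < n → Offset n a b s → b ≡ (a + s) % n
Offset⇒% b<n (inj₁ refl) = sym (m<n⇒m%n≡m b<n)
Offset⇒% {n} {a} {b} {s} b<n (inj₂ b+n≡a+s) = begin
  b            ≡⟨ m<n⇒m%n≡m b<n ⟨
  b % n        ≡⟨ [m+n]%n≡m%n b n ⟨
  (b + n) % n  ≡⟨ cong (_% n) b+n≡a+s ⟩
  (a + s) % n  ∎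
  where open ≡-Reasoning

periodic-respectsGaps : ∀ {n} C → ValidCycle C → length C ∣ n → RespectsGaps n (periodic C)
periodic-respectsGaps {n} [] _ 0∣n _ _ a<n = ⊥-elim (<⇒≱ a<n (≤-trans (≤-reflexive (0∣⇒≡0 0∣n)) z≤n))
periodic-respectsGaps {suc n} C@(_ ∷ _) valid N∣n {a} {b} {s} 1≤s s≤12 _ b<n offset =
  subst (λ x → minGap s ≤ ∣ periodic C a - x ∣) (begin
    periodic C (a + s)                        ≡⟨⟩
    C ! ((a + s) % length C)                  ≡⟨ cong (C !_) (m∣n⇒o%n%m≡o%m (length C) (suc n) (a + s) N∣n) ⟨
    C ! ((a + s) % suc n % length C)          ≡⟨ cong (λ x → C ! (x % length C)) (Offset⇒% {a = a} b<n offset) ⟨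
    periodic C b                              ∎)
    (ValidCycle⇒HasGap C valid (s≤s z≤n) a 1≤s s≤12)
  where open ≡-Reasoning

module Prefixed (P : List ℕ) (12≤N : 12 ≤ length P) where

  private
    N = length P
    0<N : 0 < N
    0<N = ≤-trans (s≤s z≤n) 12≤N
    instance
      N-nonZero : NonZero N
      N-nonZero = >-nonZero 0<N

  prefixed : List ℕ → ℕ → ℕ
  prefixed w i = if does (i <? length w) then w ! i else periodic P (i ∸ length w)

  prefixed-< : ∀ w {i} → i < length w → prefixed w i ≡ w ! i
  prefixed-< w {i} i<t rewrite dec-true (i <? length w) i<t = refl

  prefixed-≥ : ∀ w {i} → length w ≤ i → prefixed w i ≡ periodic P (i ∸ length w)
  prefixed-≥ w {i} t≤i rewrite dec-false (i <? length w) (≤⇒≯ t≤i) = refl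

  prefixed-≤ : ∀ {B} {w} → All (_≤ B) w → All (_≤ B) P → ∀ i → prefixed w i ≤ B
  prefixed-≤ {w = w} w≤B P≤B i with i <? length w
  ... | yes i<t = subst (_≤ _) (sym (prefixed-< w i<t)) (!-≤ w≤B i)
  ... | no i≮t  = subst (_≤ _) (sym (prefixed-≥ w (≮⇒≥ i≮t))) (periodic-≤ P≤B _)

  PrefixGaps : List ℕ → Set
  PrefixGaps w = All (λ a → All (HasGap (prefixed w) a) offsets) (upTo (length w))

  prefixGaps? : ∀ w → Dec (PrefixGaps w)
  prefixGaps? w = All.all? (λ a → All.all? (hasGap? (prefixed w) a) offsets) (upTo (length w))

  -- Pairs that wrap around the cycle: position b < s of w and the position s before it, which has
  -- phase N + b ∸ s in the last copy of P.
  WrapGaps : List ℕ → Set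
  WrapGaps w = All (λ b → All (λ s → b < s → minGap s ≤ ∣ periodic P (N + b ∸ s) - w ! b ∣) offsets) (upTo 12)

  wrapGaps? : ∀ w → Dec (WrapGaps w)
  wrapGaps? w =
    All.all? (λ b → All.all? (λ s → b <? s →-dec minGap s ≤? ∣ periodic P (N + b ∸ s) - w ! b ∣) offsets) (upTo 12)

  module _ (w : List ℕ) (12≤t : 12 ≤ length w) (k : ℕ) where
    private
      t = length w
      n = t + N * suc k

    prefixed-wrapGap : WrapGaps w → ∀ {a b s} → 1 ≤ s → s ≤ 12 → a < n → b + n ≡ a + s →
                       minGap s ≤ ∣ prefixed w a - prefixed w b ∣
    prefixed-wrapGap wrapGaps {a} {b} {s} 1≤s s≤12 a<n b+n≡a+s =
      subst₂ (λ x y → minGap s ≤ ∣ x - y ∣) (sym prefixed-a) (sym (prefixed-< w (<-≤-trans b<12 12≤t)))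
        (All.lookup (All.lookup wrapGaps (∈-upTo⁺ b<12)) (∈-offsets 1≤s s≤12) b<s)
      where
      b<s : b < s
      b<s = +-cancelʳ-< n b s (begin-strict
        b + n  ≡⟨ b+n≡a+s ⟩
        a + s  <⟨ +-monoˡ-< s a<n ⟩
        n + s  ≡⟨ +-comm n s ⟩
        s + n  ∎)
        where open ≤-Reasoning
      b<12 : b < 12
      b<12 = <-≤-trans b<s s≤12
      x = N + b ∸ s
      x+s≡N+b : x + s ≡ N + b
      x+s≡N+b = m∸n+n≡m (≤-trans s≤12 (≤-trans 12≤N (m≤m+n N b)))
      a≡ : a ≡ t + (x + k * N)
      a≡ = +-cancelʳ-≡ s _ _ (begin
        a + s                  ≡⟨ b+n≡a+s ⟨
        b + (t + N * suc k)    ≡⟨ solve 4 (λ b t N k → b :+ (t :+ N :* (con 1 :+ k)) := t :+ (N :+ b :+ k :* N))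
                                         refl b t N k ⟩
        t + (N + b + k * N)    ≡⟨ cong (λ y → t + (y + k * N)) x+s≡N+b ⟨
        t + (x + s + k * N)    ≡⟨ solve 4 (λ t x s kN → t :+ (x :+ s :+ kN) := t :+ (x :+ kN) :+ s)
                                         refl t x s (k * N) ⟩
        t + (x + k * N) + s    ∎)
        where open ≡-Reasoning
      prefixed-a : prefixed w a ≡ periodic P x
      prefixed-a = begin
        prefixed w a               ≡⟨ prefixed-≥ w (≤-trans (m≤m+n t _) (≤-reflexive (sym a≡))) ⟩
        periodic P (a ∸ t)         ≡⟨ cong (λ y → periodic P (y ∸ t)) a≡ ⟩
        periodic P (t + (x + k * N) ∸ t) ≡⟨ cong (periodic P) (m+n∸m≡n t _) ⟩
        periodic P (x + k * N)     ≡⟨ periodic-+* P x k ⟩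
        periodic P x               ∎
        where open ≡-Reasoning

    prefixed-respectsGaps : ValidCycle P → PrefixGaps w → WrapGaps w → RespectsGaps n (prefixed w)
    prefixed-respectsGaps valid prefixGaps wrapGaps {a} {s = s} 1≤s s≤12 a<n _ (inj₁ refl) with a <? t
    ... | yes a<t = All.lookup (All.lookup prefixGaps (∈-upTo⁺ a<t)) (∈-offsets 1≤s s≤12)
    ... | no a≮t = subst₂ (λ x y → minGap s ≤ ∣ x - y ∣) (sym (prefixed-≥ w t≤a)) (begin
      periodic P (a ∸ t + s)  ≡⟨ cong (periodic P) (+-∸-comm s t≤a) ⟨
      periodic P (a + s ∸ t)  ≡⟨ prefixed-≥ w (≤-trans t≤a (m≤m+n a s)) ⟨
      prefixed w (a + s)      ∎)
      (ValidCycle⇒HasGap P valid 0<N (a ∸ t) 1≤s s≤12)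
      where
      open ≡-Reasoning
      t≤a = ≮⇒≥ a≮t
    prefixed-respectsGaps _ _ wrapGaps 1≤s s≤12 a<n _ (inj₂ b+n≡a+s) =
      prefixed-wrapGap wrapGaps 1≤s s≤12 a<n b+n≡a+s

-- Upper bounds

%-split : ∀ d .{{_ : NonZero d}} {t n} → t % d ≡ n % d → t + d ≤ n → ∃ λ q → n ≡ t + d * suc q
%-split d {t} {n} t%d≡n%d t+d≤n = q , n≡t+d*[1+q]
  where
  1+t/d≤n/d : suc (t / d) ≤ n / d
  1+t/d≤n/d = begin
    suc (t / d)           ≡⟨ cong (λ x → suc (x / d)) (m+n∸n≡m t d) ⟨
    suc ((t + d ∸ d) / d) ≡⟨ m/n≡1+[m∸n]/n (m≤n+m d t) ⟨
    (t + d) / d           ≤⟨ /-monoˡ-≤ d t+d≤n ⟩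
    n / d                 ∎
    where open ≤-Reasoning
  q = n / d ∸ suc (t / d)
  n≡t+d*[1+q] : n ≡ t + d * suc q
  n≡t+d*[1+q] = begin
    n                             ≡⟨ m≡m%n+[m/n]*n n d ⟩
    n % d + n / d * d             ≡⟨ cong₂ (λ r b → r + b * d) t%d≡n%d (m+[n∸m]≡n 1+t/d≤n/d) ⟨
    t % d + (suc (t / d) + q) * d ≡⟨ solve 4 (λ r a q d → r :+ (con 1 :+ a :+ q) :* d
                                                    := r :+ a :* d :+ d :* (con 1 :+ q)) refl (t % d) (t / d) q d ⟩
    t % d + t / d * d + d * suc q ≡⟨ cong (_+ d * suc q) (m≡m%n+[m/n]*n t d) ⟨
    t + d * suc q                 ∎
    where open ≡-Reasoning

-- The labels 5i mod 17 (0 ≤ i < 17) with the label 16 removed.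
pattern16 : List ℕ
pattern16 = 0 ∷ 5 ∷ 10 ∷ 15 ∷ 3 ∷ 8 ∷ 13 ∷ 1 ∷ 6 ∷ 11 ∷ 4 ∷ 9 ∷ 14 ∷ 2 ∷ 7 ∷ 12 ∷ []

open Prefixed pattern16 (toWitness {a? = 12 ≤? 16} tt)

-- Prefix words found by computer search, one for each residue of n mod 16; the catch-all clause
-- (residue 0) is pattern16 itself.
residueWord : ℕ → List ℕ
residueWord 1 =
  0 ∷ 5 ∷ 10 ∷ 15 ∷ 3 ∷ 8 ∷ 13 ∷ 1 ∷ 6 ∷ 11 ∷ 16 ∷ 4 ∷ 9 ∷ 14 ∷ 2 ∷ 7 ∷ 12 ∷ []
residueWord 2 =
  0 ∷ 5 ∷ 10 ∷ 15 ∷ 3 ∷ 8 ∷ 13 ∷ 1 ∷ 6 ∷ 11 ∷ 16 ∷ 4 ∷ 9 ∷ 14 ∷ 0 ∷ 7 ∷ 12 ∷ 2 ∷ 10 ∷ 15 ∷ 5 ∷ 8 ∷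
  13 ∷ 3 ∷ 0 ∷ 11 ∷ 6 ∷ 9 ∷ 14 ∷ 4 ∷ 16 ∷ 12 ∷ 2 ∷ 7 ∷ []
residueWord 3 =
  0 ∷ 5 ∷ 10 ∷ 15 ∷ 3 ∷ 8 ∷ 13 ∷ 1 ∷ 6 ∷ 11 ∷ 16 ∷ 4 ∷ 9 ∷ 14 ∷ 0 ∷ 7 ∷ 12 ∷ 2 ∷ 5 ∷ 10 ∷ 15 ∷ 8 ∷
  13 ∷ 3 ∷ 0 ∷ 11 ∷ 16 ∷ 6 ∷ 9 ∷ 14 ∷ 4 ∷ 12 ∷ 2 ∷ 7 ∷ 0 ∷ 15 ∷ 5 ∷ 10 ∷ 13 ∷ 3 ∷ 8 ∷ 1 ∷ 6 ∷ 11 ∷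
  14 ∷ 4 ∷ 9 ∷ 16 ∷ 2 ∷ 7 ∷ 12 ∷ []
residueWord 4 =
  0 ∷ 5 ∷ 10 ∷ 15 ∷ 3 ∷ 8 ∷ 13 ∷ 1 ∷ 6 ∷ 11 ∷ 16 ∷ 4 ∷ 9 ∷ 14 ∷ 0 ∷ 7 ∷ 12 ∷ 2 ∷ 5 ∷ 10 ∷ 15 ∷ 8 ∷
  13 ∷ 3 ∷ 0 ∷ 11 ∷ 16 ∷ 6 ∷ 9 ∷ 14 ∷ 4 ∷ 1 ∷ 12 ∷ 7 ∷ 10 ∷ 15 ∷ 5 ∷ 0 ∷ 13 ∷ 3 ∷ 8 ∷ 11 ∷ 16 ∷
  6 ∷ 1 ∷ 14 ∷ 9 ∷ 12 ∷ 4 ∷ 7 ∷ 2 ∷ 15 ∷ 10 ∷ 0 ∷ 5 ∷ 8 ∷ 13 ∷ 3 ∷ 11 ∷ 1 ∷ 6 ∷ 9 ∷ 14 ∷ 4 ∷ 16 ∷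
  12 ∷ 2 ∷ 7 ∷ []
residueWord 5 =
  0 ∷ 5 ∷ 10 ∷ 3 ∷ 8 ∷ 13 ∷ 1 ∷ 6 ∷ 11 ∷ 16 ∷ 4 ∷ 9 ∷ 14 ∷ 2 ∷ 7 ∷ 12 ∷ 0 ∷ 10 ∷ 15 ∷ 3 ∷ 6 ∷ 13 ∷
  1 ∷ 8 ∷ 11 ∷ 16 ∷ 5 ∷ 14 ∷ 2 ∷ 7 ∷ 12 ∷ 0 ∷ 9 ∷ 4 ∷ 15 ∷ 6 ∷ 13 ∷ 1 ∷ 8 ∷ 3 ∷ 16 ∷ 10 ∷ 5 ∷ 12 ∷
  0 ∷ 7 ∷ 2 ∷ 15 ∷ 9 ∷ 4 ∷ 11 ∷ 6 ∷ 13 ∷ 16 ∷ 8 ∷ 0 ∷ 3 ∷ 10 ∷ 5 ∷ 12 ∷ 7 ∷ 1 ∷ 14 ∷ 9 ∷ 16 ∷ 4 ∷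
  11 ∷ 2 ∷ 13 ∷ 8 ∷ 0 ∷ 5 ∷ 10 ∷ 15 ∷ 3 ∷ 12 ∷ 1 ∷ 6 ∷ 9 ∷ 16 ∷ 4 ∷ 11 ∷ 14 ∷ 2 ∷ 7 ∷ []
residueWord 6 =
  0 ∷ 5 ∷ 10 ∷ 16 ∷ 3 ∷ 8 ∷ 14 ∷ 1 ∷ 6 ∷ 12 ∷ 4 ∷ 9 ∷ 15 ∷ 0 ∷ 7 ∷ 13 ∷ 2 ∷ 10 ∷ 16 ∷ 5 ∷ 8 ∷ 14 ∷
  3 ∷ 0 ∷ 12 ∷ 6 ∷ 9 ∷ 15 ∷ 4 ∷ 1 ∷ 13 ∷ 7 ∷ 10 ∷ 16 ∷ 5 ∷ 2 ∷ 14 ∷ 8 ∷ 0 ∷ 12 ∷ 6 ∷ 3 ∷ 15 ∷ 9 ∷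
  1 ∷ 13 ∷ 7 ∷ 4 ∷ 11 ∷ 16 ∷ 2 ∷ 14 ∷ 8 ∷ 5 ∷ 12 ∷ 0 ∷ 3 ∷ 10 ∷ 15 ∷ 7 ∷ 13 ∷ 1 ∷ 4 ∷ 11 ∷ 16 ∷
  6 ∷ 9 ∷ 14 ∷ 2 ∷ 12 ∷ []
residueWord 7 =
  0 ∷ 5 ∷ 10 ∷ 15 ∷ 8 ∷ 13 ∷ 1 ∷ 4 ∷ 11 ∷ 16 ∷ 6 ∷ 9 ∷ 14 ∷ 3 ∷ 12 ∷ 0 ∷ 5 ∷ 10 ∷ 15 ∷ 7 ∷ 2 ∷
  13 ∷ 4 ∷ 11 ∷ 16 ∷ 8 ∷ 0 ∷ 14 ∷ 6 ∷ 3 ∷ 12 ∷ 9 ∷ 1 ∷ 15 ∷ 7 ∷ 4 ∷ 13 ∷ 10 ∷ 2 ∷ 16 ∷ 8 ∷ 0 ∷ 5 ∷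
  12 ∷ 3 ∷ 14 ∷ 9 ∷ 1 ∷ 6 ∷ 11 ∷ 16 ∷ 4 ∷ 13 ∷ 2 ∷ 7 ∷ 10 ∷ 0 ∷ 5 ∷ 12 ∷ 15 ∷ 3 ∷ 8 ∷ 1 ∷ 6 ∷ 11 ∷
  14 ∷ 4 ∷ 9 ∷ 16 ∷ 2 ∷ 7 ∷ []
residueWord 8 =
  0 ∷ 5 ∷ 15 ∷ 3 ∷ 8 ∷ 13 ∷ 1 ∷ 6 ∷ 11 ∷ 16 ∷ 9 ∷ 14 ∷ 2 ∷ 7 ∷ 12 ∷ 0 ∷ 5 ∷ 10 ∷ 3 ∷ 16 ∷ 8 ∷ 1 ∷
  14 ∷ 6 ∷ 12 ∷ 4 ∷ 9 ∷ 2 ∷ 15 ∷ 7 ∷ 0 ∷ 13 ∷ 5 ∷ 11 ∷ 3 ∷ 16 ∷ 9 ∷ 1 ∷ 14 ∷ 7 ∷ 12 ∷ 4 ∷ 10 ∷ 2 ∷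
  15 ∷ 8 ∷ 0 ∷ 13 ∷ 6 ∷ 11 ∷ 16 ∷ 4 ∷ 9 ∷ 14 ∷ 2 ∷ 7 ∷ []
residueWord 9 =
  0 ∷ 5 ∷ 10 ∷ 3 ∷ 16 ∷ 8 ∷ 1 ∷ 14 ∷ 6 ∷ 12 ∷ 4 ∷ 9 ∷ 2 ∷ 15 ∷ 7 ∷ 0 ∷ 13 ∷ 5 ∷ 11 ∷ 3 ∷ 16 ∷ 9 ∷
  1 ∷ 14 ∷ 7 ∷ 12 ∷ 4 ∷ 10 ∷ 2 ∷ 15 ∷ 8 ∷ 0 ∷ 13 ∷ 6 ∷ 11 ∷ 16 ∷ 4 ∷ 9 ∷ 14 ∷ 2 ∷ 7 ∷ []
residueWord 10 =
  0 ∷ 5 ∷ 10 ∷ 3 ∷ 16 ∷ 8 ∷ 1 ∷ 14 ∷ 6 ∷ 12 ∷ 4 ∷ 9 ∷ 2 ∷ 15 ∷ 7 ∷ 0 ∷ 13 ∷ 5 ∷ 11 ∷ 3 ∷ 16 ∷ 9 ∷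
  1 ∷ 14 ∷ 7 ∷ 12 ∷ 4 ∷ 10 ∷ 2 ∷ 15 ∷ 8 ∷ 0 ∷ 13 ∷ 6 ∷ 11 ∷ 16 ∷ 4 ∷ 9 ∷ 14 ∷ 2 ∷ 7 ∷ 12 ∷ []
residueWord 11 =
  0 ∷ 5 ∷ 10 ∷ 15 ∷ 3 ∷ 8 ∷ 13 ∷ 1 ∷ 6 ∷ 11 ∷ 16 ∷ 4 ∷ 9 ∷ 14 ∷ 2 ∷ 7 ∷ 12 ∷ 0 ∷ 5 ∷ 10 ∷ 3 ∷ 16 ∷
  8 ∷ 1 ∷ 14 ∷ 6 ∷ 12 ∷ 4 ∷ 9 ∷ 2 ∷ 15 ∷ 7 ∷ 0 ∷ 13 ∷ 5 ∷ 11 ∷ 3 ∷ 16 ∷ 9 ∷ 1 ∷ 14 ∷ 7 ∷ 12 ∷ 4 ∷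
  10 ∷ 2 ∷ 15 ∷ 8 ∷ 0 ∷ 13 ∷ 6 ∷ 11 ∷ 16 ∷ 4 ∷ 9 ∷ 14 ∷ 2 ∷ 7 ∷ 12 ∷ []
residueWord 12 =
  0 ∷ 5 ∷ 10 ∷ 3 ∷ 8 ∷ 13 ∷ 1 ∷ 6 ∷ 11 ∷ 16 ∷ 4 ∷ 9 ∷ 2 ∷ 7 ∷ 12 ∷ 0 ∷ 5 ∷ 10 ∷ 15 ∷ 3 ∷ 13 ∷ 1 ∷
  6 ∷ 11 ∷ 16 ∷ 4 ∷ 9 ∷ 14 ∷ 7 ∷ 12 ∷ 0 ∷ 5 ∷ 10 ∷ 15 ∷ 3 ∷ 8 ∷ 1 ∷ 6 ∷ 11 ∷ 16 ∷ 4 ∷ 9 ∷ 14 ∷ 2 ∷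
  12 ∷ 0 ∷ 5 ∷ 10 ∷ 15 ∷ 3 ∷ 8 ∷ 13 ∷ 6 ∷ 11 ∷ 16 ∷ 4 ∷ 9 ∷ 14 ∷ 2 ∷ 7 ∷ []
residueWord 13 =
  0 ∷ 5 ∷ 10 ∷ 3 ∷ 8 ∷ 13 ∷ 1 ∷ 6 ∷ 11 ∷ 16 ∷ 4 ∷ 9 ∷ 2 ∷ 7 ∷ 12 ∷ 0 ∷ 5 ∷ 10 ∷ 15 ∷ 3 ∷ 8 ∷ 1 ∷
  6 ∷ 11 ∷ 16 ∷ 4 ∷ 9 ∷ 14 ∷ 2 ∷ 12 ∷ 0 ∷ 5 ∷ 10 ∷ 15 ∷ 3 ∷ 8 ∷ 13 ∷ 6 ∷ 11 ∷ 16 ∷ 4 ∷ 9 ∷ 14 ∷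
  2 ∷ 7 ∷ []
residueWord 14 =
  0 ∷ 5 ∷ 10 ∷ 3 ∷ 8 ∷ 13 ∷ 1 ∷ 6 ∷ 11 ∷ 16 ∷ 4 ∷ 9 ∷ 2 ∷ 7 ∷ 12 ∷ 0 ∷ 5 ∷ 10 ∷ 15 ∷ 3 ∷ 8 ∷ 1 ∷
  6 ∷ 11 ∷ 14 ∷ 4 ∷ 9 ∷ 16 ∷ 2 ∷ 7 ∷ []
residueWord 15 =
  0 ∷ 5 ∷ 10 ∷ 3 ∷ 8 ∷ 13 ∷ 1 ∷ 6 ∷ 11 ∷ 16 ∷ 4 ∷ 9 ∷ 2 ∷ 7 ∷ 12 ∷ []
residueWord _ = pattern16

cycle60 : List ℕ
cycle60 =
  0 ∷ 10 ∷ 15 ∷ 3 ∷ 8 ∷ 13 ∷ 1 ∷ 6 ∷ 16 ∷ 4 ∷ 9 ∷ 14 ∷ 2 ∷ 7 ∷ 12 ∷ 0 ∷ 10 ∷ 15 ∷ 3 ∷ 8 ∷ 13 ∷ 1 ∷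
  6 ∷ 16 ∷ 4 ∷ 9 ∷ 14 ∷ 2 ∷ 7 ∷ 12 ∷ 0 ∷ 10 ∷ 15 ∷ 3 ∷ 8 ∷ 13 ∷ 1 ∷ 6 ∷ 16 ∷ 4 ∷ 9 ∷ 14 ∷ 2 ∷ 7 ∷
  12 ∷ 0 ∷ 10 ∷ 15 ∷ 3 ∷ 8 ∷ 13 ∷ 1 ∷ 6 ∷ 16 ∷ 4 ∷ 9 ∷ 14 ∷ 2 ∷ 7 ∷ 12 ∷ []

cycle69 : List ℕ
cycle69 =
  15 ∷ 0 ∷ 7 ∷ 13 ∷ 2 ∷ 10 ∷ 16 ∷ 5 ∷ 8 ∷ 14 ∷ 3 ∷ 11 ∷ 0 ∷ 6 ∷ 9 ∷ 15 ∷ 4 ∷ 12 ∷ 1 ∷ 7 ∷ 10 ∷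
  16 ∷ 5 ∷ 13 ∷ 2 ∷ 8 ∷ 11 ∷ 0 ∷ 6 ∷ 14 ∷ 3 ∷ 9 ∷ 16 ∷ 1 ∷ 7 ∷ 12 ∷ 4 ∷ 10 ∷ 15 ∷ 2 ∷ 8 ∷ 13 ∷ 0 ∷
  5 ∷ 11 ∷ 16 ∷ 3 ∷ 14 ∷ 1 ∷ 6 ∷ 12 ∷ 8 ∷ 4 ∷ 10 ∷ 15 ∷ 2 ∷ 13 ∷ 0 ∷ 5 ∷ 11 ∷ 16 ∷ 3 ∷ 8 ∷ 14 ∷
  1 ∷ 6 ∷ 12 ∷ 4 ∷ 9 ∷ []

cycle70 : List ℕ
cycle70 =
  16 ∷ 13 ∷ 8 ∷ 3 ∷ 0 ∷ 10 ∷ 5 ∷ 15 ∷ 7 ∷ 2 ∷ 12 ∷ 9 ∷ 4 ∷ 14 ∷ 0 ∷ 6 ∷ 16 ∷ 11 ∷ 8 ∷ 3 ∷ 13 ∷ 1 ∷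
  5 ∷ 15 ∷ 10 ∷ 7 ∷ 12 ∷ 0 ∷ 4 ∷ 14 ∷ 2 ∷ 9 ∷ 16 ∷ 11 ∷ 6 ∷ 13 ∷ 1 ∷ 8 ∷ 15 ∷ 3 ∷ 10 ∷ 5 ∷ 0 ∷ 7 ∷
  14 ∷ 2 ∷ 12 ∷ 16 ∷ 4 ∷ 9 ∷ 6 ∷ 1 ∷ 11 ∷ 15 ∷ 3 ∷ 13 ∷ 8 ∷ 5 ∷ 0 ∷ 10 ∷ 16 ∷ 2 ∷ 12 ∷ 7 ∷ 4 ∷
  14 ∷ 9 ∷ 1 ∷ 11 ∷ 6 ∷ []

cycle71 : List ℕ
cycle71 =
  14 ∷ 2 ∷ 7 ∷ 12 ∷ 0 ∷ 5 ∷ 10 ∷ 16 ∷ 3 ∷ 8 ∷ 14 ∷ 1 ∷ 6 ∷ 12 ∷ 4 ∷ 9 ∷ 15 ∷ 0 ∷ 7 ∷ 13 ∷ 2 ∷ 10 ∷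
  16 ∷ 5 ∷ 8 ∷ 14 ∷ 3 ∷ 0 ∷ 12 ∷ 6 ∷ 9 ∷ 15 ∷ 4 ∷ 1 ∷ 13 ∷ 7 ∷ 10 ∷ 16 ∷ 5 ∷ 2 ∷ 14 ∷ 8 ∷ 0 ∷ 12 ∷
  6 ∷ 3 ∷ 10 ∷ 15 ∷ 1 ∷ 13 ∷ 7 ∷ 4 ∷ 11 ∷ 16 ∷ 2 ∷ 9 ∷ 14 ∷ 6 ∷ 12 ∷ 0 ∷ 3 ∷ 10 ∷ 15 ∷ 5 ∷ 8 ∷
  13 ∷ 1 ∷ 11 ∷ 16 ∷ 4 ∷ 9 ∷ []

cycle85 : List ℕ
cycle85 =
  0 ∷ 5 ∷ 10 ∷ 15 ∷ 3 ∷ 8 ∷ 13 ∷ 1 ∷ 6 ∷ 11 ∷ 16 ∷ 4 ∷ 9 ∷ 14 ∷ 2 ∷ 7 ∷ 12 ∷ 0 ∷ 5 ∷ 10 ∷ 15 ∷ 3 ∷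
  8 ∷ 13 ∷ 1 ∷ 6 ∷ 11 ∷ 16 ∷ 4 ∷ 9 ∷ 14 ∷ 2 ∷ 7 ∷ 12 ∷ 0 ∷ 5 ∷ 10 ∷ 15 ∷ 3 ∷ 8 ∷ 13 ∷ 1 ∷ 6 ∷ 11 ∷
  16 ∷ 4 ∷ 9 ∷ 14 ∷ 2 ∷ 7 ∷ 12 ∷ 0 ∷ 5 ∷ 10 ∷ 15 ∷ 3 ∷ 8 ∷ 13 ∷ 1 ∷ 6 ∷ 11 ∷ 16 ∷ 4 ∷ 9 ∷ 14 ∷ 2 ∷
  7 ∷ 12 ∷ 0 ∷ 5 ∷ 10 ∷ 15 ∷ 3 ∷ 8 ∷ 13 ∷ 1 ∷ 6 ∷ 11 ∷ 16 ∷ 4 ∷ 9 ∷ 14 ∷ 2 ∷ 7 ∷ 12 ∷ []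

-- Cyclic words for the lengths n ≥ 57 below length (residueWord (n % 16)) + 16.
smallCycles : List (List ℕ)
smallCycles = residueWord 11 ∷ cycle60 ∷ residueWord 4 ∷ cycle69 ∷ cycle70 ∷ cycle71 ∷ cycle85 ∷ []

GoodResidueWord : ℕ → List ℕ → Set
GoodResidueWord r w =
  12 ≤ length w × length w % 16 ≡ r × length w ≤ 85 × All (_≤ 16) w × PrefixGaps w × WrapGaps w

goodResidueWord? : ∀ r w → Dec (GoodResidueWord r w)
goodResidueWord? r w = 12 ≤? length w ×-dec length w % 16 ≟ r ×-dec length w ≤? 85 ×-dec All.all? (_≤? 16) w
                     ×-dec prefixGaps? w ×-dec wrapGaps? w

GoodCycle : List ℕ → Set
GoodCycle C = ValidCycle C × All (_≤ 16) C

CoveredBySmallCycle : ℕ → Set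
CoveredBySmallCycle n = 57 ≤ n → n < length (residueWord (n % 16)) + 16 → Any (λ C → length C ≡ n) smallCycles

-- Closed by evaluation; opaque so that later type checking never unfolds these large proof terms.
opaque
  pattern16-valid : ValidCycle pattern16
  pattern16-valid = toWitness {a? = validCycle? pattern16} tt

  pattern16-≤15 : All (_≤ 15) pattern16
  pattern16-≤15 = toWitness {a? = All.all? (_≤? 15) pattern16} tt

  residueWords-good : All (λ r → GoodResidueWord r (residueWord r)) (upTo 16)
  residueWords-good = toWitness {a? = All.all? (λ r → goodResidueWord? r (residueWord r)) (upTo 16)} tt

  smallCycles-good : All GoodCycle smallCycles
  smallCycles-good = toWitness {a? = All.all? (λ C → validCycle? C ×-dec All.all? (_≤? 16) C) smallCycles} tt

  smallCycles-cover : All CoveredBySmallCycle (upTo 101)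
  smallCycles-cover = toWitness {a? = All.all? (λ n → 57 ≤? n →-dec n <? length (residueWord (n % 16)) + 16 →-dec
                                                       Any.any? (λ C → length C ≟ n) smallCycles) (upTo 101)} tt

Labelling≤16 : ℕ → Set
Labelling≤16 n = ∃ λ W → RespectsGaps n W × (∀ i → W i ≤ 16)

cycleLabelling : ∀ {n C} → GoodCycle C → length C ≡ n → Labelling≤16 n
cycleLabelling {C = C} (valid , C≤16) |C|≡n =
  periodic C , periodic-respectsGaps C valid (∣-reflexive |C|≡n) , periodic-≤ C≤16

prefixedLabelling : ∀ {n r} → GoodResidueWord r (residueWord r) → r ≡ n % 16 → length (residueWord r) + 16 ≤ n →
                    Labelling≤16 n
prefixedLabelling {n} {r} (12≤t , t%16≡r , _ , w≤16 , prefixGaps , wrapGaps) r≡n%16 t+16≤n =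
  prefixed w , subst (λ m → RespectsGaps m (prefixed w)) (sym n≡t+16[1+q])
                 (prefixed-respectsGaps w 12≤t q pattern16-valid prefixGaps wrapGaps) ,
  prefixed-≤ w≤16 (All.map (λ x≤15 → ≤-trans x≤15 (n≤1+n 15)) pattern16-≤15)
  where
  w = residueWord r
  split = %-split 16 (trans t%16≡r r≡n%16) t+16≤n
  q = proj₁ split
  n≡t+16[1+q] = proj₂ split

labelling≤16 : ∀ n → 57 ≤ n → Labelling≤16 n
labelling≤16 n 57≤n = byLength (n <? length (residueWord r) + 16)
  where
  r = n % 16
  good : GoodResidueWord r (residueWord r)
  good = All.lookup residueWords-good (∈-upTo⁺ (m%n<n n 16))
  byLength : Dec (n < length (residueWord r) + 16) → Labelling≤16 n
  byLength (yes n<t+16) =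
    All.lookupWith cycleLabelling smallCycles-good (All.lookup smallCycles-cover (∈-upTo⁺ n<101) 57≤n n<t+16)
    where n<101 = <-≤-trans n<t+16 (+-monoˡ-≤ 16 (proj₁ (proj₂ (proj₂ good))))
  byLength (no n≮t+16) = prefixedLabelling good refl (≮⇒≥ n≮t+16)

span≤16 : ∀ n → 57 ≤ n → Lambda321≤ n (S₁₄ n) 16
span≤16 n 57≤n with labelling≤16 n 57≤n
... | W , gaps , W≤16 =
  W ∘ toℕ , respectsGaps⇒IsL321 W (≤-trans (toWitness {a? = 13 ≤? 57} tt) 57≤n) gaps ,
  span≤ {n} (W ∘ toℕ) (W≤16 ∘ toℕ)

span≡15 : ∀ n → 57 ≤ n → 16 ∣ n → Σ (Fin n → ℕ) λ f → IsL321 (CircAdj n (S₁₄ n)) f × span n f ≡ 15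
span≡15 n 57≤n 16∣n =
  f , respectsGaps⇒IsL321 (periodic pattern16) (≤-trans (toWitness {a? = 13 ≤? 57} tt) 57≤n)
        (periodic-respectsGaps pattern16 pattern16-valid 16∣n) ,
  span≡ f (fromℕ< 0<n) (fromℕ< 3<n) (periodic-≤ pattern16-≤15 ∘ toℕ)
    (cong (periodic pattern16) (toℕ-fromℕ< 0<n)) (cong (periodic pattern16) (toℕ-fromℕ< 3<n))
  where
  f = periodic pattern16 ∘ toℕ
  3<n = ≤-trans (toWitness {a? = 4 ≤? 57} tt) 57≤n
  0<n = ≤-trans (s≤s z≤n) 3<n

-- Lower bound

Walk-map : ∀ {V W : Set} {A : V → V → Set} {B : W → W → Set} (f : V → W) →
           (∀ {u v} → A u v → B (f u) (f v)) → ∀ {x y k} → Walk A x y k → Walk B (f x) (f y) k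
Walk-map f A⇒B here         = here
Walk-map f A⇒B (step xy yz) = step (A⇒B xy) (Walk-map f A⇒B yz)

LineAdj : ℕ → ℕ → Set
LineAdj p q = p ≤ 12 × q ≤ 12 × ∣ p - q ∣ ∈ 1 ∷ 4 ∷ []

lineAdj? : ∀ p q → Dec (LineAdj p q)
lineAdj? p q = p ≤? 12 ×-dec q ≤? 12 ×-dec ∣ p - q ∣ ∈? 1 ∷ 4 ∷ []

via : ∀ {p r k} q → {True (lineAdj? p q)} → Walk LineAdj q r k → Walk LineAdj p r (suc k)
via q {pq} w = step (toWitness pq) w

lineDist-≥13 : ∀ {s} → 13 ≤ s → lineDist s ≡ 4
lineDist-≥13 (s≤s (s≤s (s≤s (s≤s (s≤s (s≤s (s≤s (s≤s (s≤s (s≤s (s≤s (s≤s (s≤s _))))))))))))) = refl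

lineDist≤3⇒≤12 : ∀ {s} → lineDist s ≤ 3 → s ≤ 12
lineDist≤3⇒≤12 {s} d≤3 with s ≤? 12
... | yes s≤12 = s≤12
... | no s≰12 = ⊥-elim (<⇒≱ (s≤s d≤3) (≤-reflexive (sym (lineDist-≥13 (≰⇒> s≰12)))))

lineGeodesic : ∀ s → lineDist s ≤ 3 → Walk LineAdj 0 s (lineDist s)
lineGeodesic 0  _ = here
lineGeodesic 1  _ = via 1 here
lineGeodesic 2  _ = via 1 (via 2 here)
lineGeodesic 3  _ = via 4 (via 3 here)
lineGeodesic 4  _ = via 4 here
lineGeodesic 5  _ = via 4 (via 5 here)
lineGeodesic 6  _ = via 4 (via 5 (via 6 here))
lineGeodesic 7  _ = via 4 (via 3 (via 7 here))
lineGeodesic 8  _ = via 4 (via 8 here)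
lineGeodesic 9  _ = via 4 (via 8 (via 9 here))
lineGeodesic 10 (s≤s (s≤s (s≤s ())))
lineGeodesic 11 (s≤s (s≤s (s≤s ())))
lineGeodesic 12 _ = via 4 (via 8 (via 12 here))
lineGeodesic (suc (suc (suc (suc (suc (suc (suc (suc (suc (suc (suc (suc (suc _))))))))))))) (s≤s (s≤s (s≤s ())))

Offset-unique : ∀ {n a s d} → 25 ≤ n → 1 ≤ s → s ≤ 12 → d ≤ 12 →
                Offset n a (a + s) d ⊎ Offset n (a + s) a d → d ≡ s
Offset-unique {a = a} _ _ _ _ (inj₁ (inj₁ a+s≡a+d)) = sym (+-cancelˡ-≡ a _ _ a+s≡a+d)
Offset-unique {n} {a} {s} {d} 25≤n _ _ d≤12 (inj₁ (inj₂ a+s+n≡a+d)) = ⊥-elim (<⇒≱ (<-≤-trans d<25 25≤n) (begin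
  n             ≤⟨ m≤n+m n s ⟩
  s + n         ≡⟨ +-cancelˡ-≡ a _ _ (trans (sym (+-assoc a s n)) a+s+n≡a+d) ⟩
  d             ∎))
  where
  open ≤-Reasoning
  d<25 = ≤-<-trans d≤12 (toWitness {a? = 12 <? 25} tt)
Offset-unique {n} {a} {s} {d} _ 1≤s _ _ (inj₂ (inj₁ a≡a+s+d)) = ⊥-elim (<⇒≢ (begin-strict
  a             <⟨ m<m+n a 1≤s ⟩
  a + s         ≤⟨ m≤m+n (a + s) d ⟩
  a + s + d     ∎) a≡a+s+d)
  where open ≤-Reasoning
Offset-unique {n} {a} {s} {d} 25≤n _ s≤12 d≤12 (inj₂ (inj₂ a+n≡a+s+d)) = ⊥-elim (<⇒≱ (<-≤-trans s+d<25 25≤n) (begin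
  n             ≡⟨ +-cancelˡ-≡ a _ _ (trans a+n≡a+s+d (+-assoc a s d)) ⟩
  s + d         ∎))
  where
  open ≤-Reasoning
  s+d<25 = ≤-<-trans (+-mono-≤ s≤12 d≤12) (toWitness {a? = 24 <? 25} tt)

module _ {n : ℕ} {{_ : NonZero n}} where

  vertex : ℕ → Fin n
  vertex i = fromℕ< (m%n<n i n)

  toℕ-vertex : ∀ {i} → i < n → toℕ (vertex i) ≡ i
  toℕ-vertex {i} i<n = trans (toℕ-fromℕ< (m%n<n i n)) (m<n⇒m%n≡m i<n)

  lineAdj⇒adjacent : ∀ {a} → a + 12 < n → ∀ {p q} → LineAdj p q →
                     CircAdj n (S₁₄ n) (vertex (a + p)) (vertex (a + q))
  lineAdj⇒adjacent {a} a+12<n {p} {q} (p≤12 , q≤12 , hop) = subst (_∈ S₁₄ n) (sym (begin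
    ∣ toℕ (vertex (a + p)) - toℕ (vertex (a + q)) ∣ ≡⟨ cong₂ ∣_-_∣ (toℕ-vertex (<n p≤12)) (toℕ-vertex (<n q≤12)) ⟩
    ∣ a + p - a + q ∣                               ≡⟨ ∣m+n-m+o∣≡∣n-o∣ a p q ⟩
    ∣ p - q ∣                                       ∎)) (++⁺ˡ hop)
    where
    open ≡-Reasoning
    <n : ∀ {r} → r ≤ 12 → a + r < n
    <n r≤12 = ≤-<-trans (+-monoʳ-≤ a r≤12) a+12<n

  vertex-dist : 25 ≤ n → ∀ {a s} → a + 12 < n → 1 ≤ s → lineDist s ≤ 3 →
                IsDist (CircAdj n (S₁₄ n)) (vertex a) (vertex (a + s)) (lineDist s)
  vertex-dist 25≤n {a} {s} a+12<n 1≤s d≤3 = geodesic , noShortcut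
    where
    s≤12 = lineDist≤3⇒≤12 d≤3
    a<n = ≤-<-trans (m≤m+n a 12) a+12<n
    a+s<n = ≤-<-trans (+-monoʳ-≤ a s≤12) a+12<n
    geodesic : Walk (CircAdj n (S₁₄ n)) (vertex a) (vertex (a + s)) (lineDist s)
    geodesic = subst (λ x → Walk (CircAdj n (S₁₄ n)) (vertex x) (vertex (a + s)) (lineDist s)) (+-identityʳ a)
      (Walk-map (λ p → vertex (a + p)) (lineAdj⇒adjacent a+12<n) (lineGeodesic s d≤3))
    noShortcut : ∀ m → m < lineDist s → ¬ Walk (CircAdj n (S₁₄ n)) (vertex a) (vertex (a + s)) m
    noShortcut m m<d walk
      with shortWalk⇒Offset (≤-trans (toWitness {a? = 13 ≤? 25} tt) 25≤n) (≤-trans (<⇒≤ m<d) d≤3) walk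
    ... | d , d≤12 , d≤m , offset = <⇒≱ m<d (subst (λ x → lineDist x ≤ m) d≡s d≤m)
      where
      d≡s = Offset-unique 25≤n 1≤s s≤12 d≤12
              (subst₂ (λ x y → Offset n x y d ⊎ Offset n y x d) (toℕ-vertex a<n) (toℕ-vertex a+s<n) offset)

  L321⇒minGaps : 25 ≤ n → ∀ {f} → IsL321 (CircAdj n (S₁₄ n)) f → ∀ {a s} → a + 12 < n → 1 ≤ s →
                 minGap s ≤ ∣ f (vertex a) - f (vertex (a + s)) ∣
  L321⇒minGaps 25≤n {f} isL {a} {s} a+12<n 1≤s with lineDist s ≤? 3
  ... | no d≰3 = ≤-trans (≤-reflexive (m≤n⇒m∸n≡0 (≰⇒> d≰3))) z≤n
  ... | yes d≤3 = m≤n+o⇒m∸n≤o 4 (lineDist s)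
                    (isL (vertex a) (vertex (a + s)) distinct (lineDist s) (vertex-dist 25≤n a+12<n 1≤s d≤3))
    where
    s≤12 = lineDist≤3⇒≤12 d≤3
    distinct : ¬ vertex a ≡ vertex (a + s)
    distinct eq = <⇒≢ (m<m+n a 1≤s) (begin
      a                       ≡⟨ toℕ-vertex (≤-<-trans (m≤m+n a 12) a+12<n) ⟨
      toℕ (vertex a)          ≡⟨ cong toℕ eq ⟩
      toℕ (vertex (a + s))    ≡⟨ toℕ-vertex (≤-<-trans (+-monoʳ-≤ a s≤12) a+12<n) ⟩
      a + s                   ∎)
      where open ≡-Reasoning

gapOK : ℕ → ℕ → ℕ → Bool
gapOK γ u v = (γ ≤ᵇ u ∸ v) ∨ (γ ≤ᵇ v ∸ u)

gapOK-complete : ∀ {γ} u v → γ ≤ ∣ u - v ∣ → T (gapOK γ u v)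
gapOK-complete {γ} u v γ≤∣u-v∣ = Equivalence.from T-∨ (Sum.map (λ e → ≤⇒≤ᵇ (subst (γ ≤_) e γ≤∣u-v∣))
                                                                    (λ e → ≤⇒≤ᵇ (subst (γ ≤_) e γ≤∣u-v∣))
                                                                    (∣m-n∣≡[m∸n]∨[n∸m] u v))

-- fits s v us: label v may follow the labels us, listed most recent first with the head s positions
-- back; offsets beyond 12 impose no gap.
fits : ℕ → ℕ → List ℕ → Bool
fits s v []       = true
fits s v (u ∷ us) = (12 <ᵇ s) ∨ (gapOK (minGap s) u v ∧ fits (suc s) v us)

anyBelow : ℕ → (ℕ → Bool) → Bool
anyBelow zero    p = false
anyBelow (suc v) p = p v ∨ anyBelow v p

anyBelow-complete : ∀ {v x} (p : ℕ → Bool) → x < v → T (p x) → T (anyBelow v p)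
anyBelow-complete {suc v} {x} p x<1+v px with x ≟ v
... | yes refl = Equivalence.from T-∨ (inj₁ px)
... | no x≢v   = Equivalence.from T-∨ (inj₂ (anyBelow-complete p (≤∧≢⇒< (≤-pred x<1+v) x≢v) px))

-- extendable k K us: the labels us (most recent first) can be followed by k more labels below K.
extendable : ℕ → ℕ → List ℕ → Bool
extendable zero    K us = true
extendable (suc k) K us = anyBelow K (λ v → fits 1 v us ∧ extendable k K (v ∷ us))

WindowGaps : ℕ → (ℕ → ℕ) → Set
WindowGaps len g = ∀ i s → 1 ≤ s → i + s < len → HasGap g i s

module _ {len g} (gaps : WindowGaps len g) where

  fits-complete : ∀ {p} → p < len → ∀ j s → 1 ≤ s → j + s ≡ suc p → T (fits s (g p) (applyDownFrom g j))
  fits-complete p<len zero    s 1≤s _ = tt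
  fits-complete {p} p<len (suc j) s 1≤s 1+j+s≡1+p = Equivalence.from T-∨ (inj₂ (Equivalence.from T-∧
    ( gapOK-complete (g j) (g p) (subst (λ x → minGap s ≤ ∣ g j - g x ∣) j+s≡p
                                         (gaps j s 1≤s (subst (_< len) (sym j+s≡p) p<len)))
    , fits-complete p<len j (suc s) (s≤s z≤n) (trans (+-suc j s) 1+j+s≡1+p))))
    where j+s≡p = suc-injective 1+j+s≡1+p

  extendable-complete : ∀ {K} → (∀ i → i < len → g i < K) → ∀ k j → j + k ≡ len →
                        T (extendable k K (applyDownFrom g j))
  extendable-complete _     zero    _ _        = tt
  extendable-complete g<K (suc k) j j+1+k≡len =
    anyBelow-complete (λ v → fits 1 v (applyDownFrom g j) ∧ extendable k _ (v ∷ applyDownFrom g j)) (g<K j j<len)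
      (Equivalence.from T-∧ ( fits-complete j<len j 1 (s≤s z≤n) (+-comm j 1)
                            , extendable-complete g<K k (suc j) (trans (sym (+-suc j k)) j+1+k≡len)))
    where j<len = subst (suc j ≤_) (trans (sym (+-suc j k)) j+1+k≡len) (s≤s (m≤m+n j k))

-- The search extendable 22 15 [] evaluates to false.
window22-unlabellable : ∀ g → WindowGaps 22 g → (∀ i → i < 22 → g i < 15) → ⊥
window22-unlabellable g gaps g<15 = extendable-complete gaps g<15 22 0 refl


∣m∸o-n∸o∣≡∣m-n∣ : ∀ {m n o} → o ≤ m → o ≤ n → ∣ m ∸ o - n ∸ o ∣ ≡ ∣ m - n ∣
∣m∸o-n∸o∣≡∣m-n∣ {m} {n} {o} o≤m o≤n =
  trans (sym (∣m+n-m+o∣≡∣n-o∣ o (m ∸ o) (n ∸ o))) (cong₂ ∣_-_∣ (m+[n∸m]≡n o≤m) (m+[n∸m]≡n o≤n))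

span≥15 : ∀ {n} → 57 ≤ n → ∀ f → IsL321 (CircAdj n (S₁₄ n)) f → 15 ≤ span n f
span≥15 {n} 57≤n f isL = ≮⇒≥ λ span<15 → window22-unlabellable g gaps (λ i _ → ≤-<-trans (g≤span i) span<15)
  where
  instance
    n-nonZero : NonZero n
    n-nonZero = >-nonZero (≤-trans (s≤s z≤n) 57≤n)
  g : ℕ → ℕ
  g i = f (vertex i) ∸ minLabel n f
  g≤span : ∀ i → g i ≤ span n f
  g≤span i = ∸-monoˡ-≤ (minLabel n f) (≤maxLabel f (vertex i))
  gaps : WindowGaps 22 g
  gaps i s 1≤s i+s<22 =
    subst (minGap s ≤_) (sym (∣m∸o-n∸o∣≡∣m-n∣ (minLabel≤ f (vertex i)) (minLabel≤ f (vertex (i + s)))))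
      (L321⇒minGaps (≤-trans (toWitness {a? = 25 ≤? 57} tt) 57≤n) {f} isL i+12<n 1≤s)
    where
    i+12<n : i + 12 < n
    i+12<n = ≤-trans (+-monoˡ-< 12 (≤-<-trans (m≤m+n i s) i+s<22)) (≤-trans (toWitness {a? = 34 ≤? 57} tt) 57≤n)

mainTheorem9 : (n : ℕ) → 57 ≤ n →
    ((∃ λ k → n ≡ 16 * k) → Lambda321≡ n (S₁₄ n) 15)
    × (¬ (∃ λ k → n ≡ 16 * k) → Lambda321≤ n (S₁₄ n) 16)
-- span≤16 holds for every n ≥ 57.
mainTheorem9 n 57≤n =
  (λ (k , n≡16k) → span≡15 n 57≤n (divides k (trans n≡16k (*-comm 16 k))) , span≥15 57≤n) ,
  (λ _ → span≤16 n 57≤n)
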